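{- Let $S$ be a non special numerical semigroup, and put $g=\operatorname{g}(S)$, $n=\operatorname{n}(S)$. Then there exists $r\in\mathbb{N}$ such that $\mathcal{A}^{r}(S)$ is defined (i.e. $S,\mathcal{A}(S),\ldots,\mathcal{A}^{r-1}(S)$ are all non special) and $$\mathcal{A}^{r}(S)=\{0\}\cup\{g,g+1,\ldots,g+n-2\}\cup\{x\in\mathbb{N}\mid x\ge g+n\};$$ that is, $\mathcal{A}^r(S)$ is an almost-ordinary numerical semigroup.
   Context: $\mathbb{N}=\{0,1,2,\ldots\}$. A numerical semigroup is a submonoid $S$ of $(\mathbb{N},+)$ with $\mathbb{N}\setminus S$ finite. $\operatorname{H}(S)=\mathbb{N}\setminus S$; $\operatorname{g}(S)=|\operatorname{H}(S)|$; $\operatorname{F}(S)=\max\operatorname{H}(S)$; $\operatorname{m}(S)=\min(S\setminus\{0\})$; $\operatorname{n}(S)=|\{s\in S\mid s<\operatorname{F}(S)\}|$. Special gaps: $\operatorname{SG}(S)=\{h\in\operatorname{H}(S)\mid 2h\in S \text{ and } h+s\in S \text{ for all } s\in S\setminus\{0\}\}$. $S$ is special if there is no $h\in\operatorname{SG}(S)\setminus\{\operatorname{F}(S)\}$ with $h>\operatorname{m}(S)$. For non special $S$, with $h=\max(\operatorname{SG}(S)\setminus\{\operatorname{F}(S)\})$, $\mathcal{A}(S)=(S\cup\{h\})\setminus\{\operatorname{m}(S)\}$; $\mathcal{A}^r$ denotes the $r$-fold iterate. A numerical semigroup is almost-ordinary if it equals $\{0\}\cup\{g,\ldots,g+n-2\}\cup\{x\in\mathbb{N}\mid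 x\ge g+n\}$ for some integers $g>2$, $n\in[2,g]$. -}

module Defs where

open import Data.Nat using (ℕ; zero; suc; _+_; _∸_; _≤_; _<_; _≤ᵇ_; _<ᵇ_; _≡ᵇ_)
open import Data.Bool using (Bool; true; false; _∧_; _∨_; not; if_then_else_)
open import Data.List using (List; []; _∷_; length)
open import Data.Maybe using (Maybe; just; nothing; _>>=_)
open import Relation.Binary.PropositionalEquality using (_≡_; _≢_)

record NumericalSemigroup : Set where
  field
    mem      : ℕ → Bool
    zero∈    : mem 0 ≡ true
    closed   : ∀ a b → mem a ≡ true → mem b ≡ true → mem (a + b) ≡ true
    bound    : ℕ
    cofinite : ∀ x → bound ≤ x → mem x ≡ true

open NumericalSemigroup public

-- All notions below are defined for a set X ⊆ ℕ given by a membership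
-- function f together with a bound B such that every x ≥ B lies in X.
-- (The results do not depend on the choice of such a B.)

gapList : (ℕ → Bool) → ℕ → List ℕ
gapList f zero    = []
gapList f (suc k) = if f k then gapList f k else (k ∷ gapList f k)

genus : (ℕ → Bool) → ℕ → ℕ
genus f B = length (gapList f B)

-- F(X) = largest gap (0 is returned when there is no gap; this value is
-- only used when X has a gap, or in counting n(X), which is 0 for X = ℕ anyway)
frob : (ℕ → Bool) → ℕ → ℕ
frob f B with gapList f B
... | []    = 0
... | h ∷ _ = h

countMem : (ℕ → Bool) → ℕ → ℕ
countMem f zero    = 0
countMem f (suc k) = if f k then suc (countMem f k) else countMem f k

nval : (ℕ → Bool) → ℕ → ℕ
nval f B with gapList f B
... | []    = 0
... | h ∷ _ = countMem f h

firstFrom : (ℕ → Bool) → ℕ → ℕ → ℕ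
firstFrom f x zero    = x
firstFrom f x (suc k) = if f x then x else firstFrom f (suc x) k

-- m(X) = min (X ∖ {0})   (search 1 .. B; B+1 ∈ X always)
mult : (ℕ → Bool) → ℕ → ℕ
mult f B = firstFrom f 1 B

allBelow : ℕ → (ℕ → Bool) → Bool
allBelow zero    p = true
allBelow (suc k) p = allBelow k p ∧ p k

-- h ∈ SG(X): h is a gap, 2h ∈ X, and h + s ∈ X for all s ∈ X ∖ {0}.
-- (For s ≥ B, h + s ≥ B lies in X automatically, so only s < B is checked.)
isSG : (ℕ → Bool) → ℕ → ℕ → Bool
isSG f B h = not (f h) ∧ f (h + h)
             ∧ allBelow B (λ s → (s ≡ᵇ 0) ∨ not (f s) ∨ f (h + s))

NonSpecial : (ℕ → Bool) → ℕ → Set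
NonSpecial f B = Σℕ
  where
  open import Data.Product using (∃-syntax; _×_)
  Σℕ : Set
  Σℕ = ∃[ h ] (isSG f B h ≡ true × h ≢ frob f B × mult f B < h)

-- SG(X) ∖ {F(X)} in decreasing order (the gap list is decreasing and
-- duplicate-free, with head F(X))
filterᵇ : (ℕ → Bool) → List ℕ → List ℕ
filterᵇ p []       = []
filterᵇ p (x ∷ xs) = if p x then x ∷ filterᵇ p xs else filterᵇ p xs

tailL : List ℕ → List ℕ
tailL []       = []
tailL (_ ∷ xs) = xs

sgMinusF : (ℕ → Bool) → ℕ → List ℕ
sgMinusF f B = filterᵇ (isSG f B) (tailL (gapList f B))

-- one step of 𝒜: defined (just) iff X is non special; then with
-- h = max (SG(X) ∖ {F(X)}), 𝒜(X) = (X ∪ {h}) ∖ {m(X)}.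
-- The same bound B remains valid for 𝒜(X) (as m(X) < h < B).
stepA : (ℕ → Bool) → ℕ → Maybe (ℕ → Bool)
stepA f B with sgMinusF f B
... | []    = nothing
... | h ∷ _ = if mult f B <ᵇ h
                then just (λ x → (f x ∨ (x ≡ᵇ h)) ∧ not (x ≡ᵇ mult f B))
                else nothing

iterA : ℕ → (ℕ → Bool) → ℕ → Maybe (ℕ → Bool)
iterA zero    f B = just f
iterA (suc r) f B = stepA f B >>= λ f′ → iterA r f′ B

almostOrdinaryMem : ℕ → ℕ → ℕ → Bool
almostOrdinaryMem g n x =
  (x ≡ᵇ 0) ∨ ((g ≤ᵇ x) ∧ (x <ᵇ (g + n) ∸ 1)) ∨ ((g + n) ≤ᵇ x)

{-# OPTIONS --safe #-}
-- Each application of 𝒜 exchanges the multiplicity m for a special gap h with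
-- m < h < F. This keeps S a numerical semigroup with the same Frobenius number,
-- the same number of gaps and the same number of elements below F, and strictly
-- raises the multiplicity, so the iteration stops after at most F − m steps.
-- In 𝒜(S), F − m(S) is a gap while every positive element exceeds m(S); this
-- forces g + m(S) ≥ F for the largest gap g below F, so g is special as soon as
-- it exceeds the multiplicity. Hence the iteration can only stop at a semigroup
-- {0} ∪ [μ, F) ∪ (F, ∞), which has μ gaps and F − μ + 1 elements below F.
module Submission where

open import Defs
open import Data.Nat
open import Data.Nat.Properties
open import Data.Bool using (Bool; true; false; _∧_; _∨_; not; if_then_else_)
open import Data.Bool.Properties using (T-≡; T-∧; T-∨; ⇔→≡; not-injective; not-¬; ¬-not; ∨-identityʳ; ∨-zeroʳ; ∧-identityʳ; ∧-zeroʳ)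
open import Data.List using ([]; _∷_; length)
open import Data.Maybe using (just; nothing)
open import Data.Product using (∃-syntax; _×_; _,_; proj₁; proj₂; map₂)
open import Data.Sum using (_⊎_; inj₁; inj₂)
import Data.Sum as Sum
open import Function.Bundles using (_⇔_; mk⇔; Equivalence)
open import Function.Construct.Composition using (_⇔-∘_)
open import Function.Construct.Symmetry using (⇔-sym)
open import Relation.Nullary using (¬_; contradiction; yes; no)
open import Relation.Binary using (tri<; tri≈; tri>)
open import Relation.Binary.PropositionalEquality

infix 4 _∈_ _∉_
infixl 6 _∪[_] _∖[_]

_∈_ _∉_ : ℕ → (ℕ → Bool) → Set
x ∈ f = f x ≡ true
x ∉ f = f x ≡ false

∧-true⁻ : ∀ {a b} → a ∧ b ≡ true → a ≡ true × b ≡ true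
∧-true⁻ {true} {true} _ = refl , refl

∨-true⁻ : ∀ {a b} → a ∨ b ≡ true → a ≡ true ⊎ b ≡ true
∨-true⁻ {true}  _ = inj₁ refl
∨-true⁻ {false} e = inj₂ e

≡ᵇ-refl : ∀ x → (x ≡ᵇ x) ≡ true
≡ᵇ-refl x = Equivalence.to T-≡ (≡⇒≡ᵇ x x refl)

≢⇒≡ᵇ≡false : ∀ {x y} → x ≢ y → (x ≡ᵇ y) ≡ false
≢⇒≡ᵇ≡false {x} {y} x≢y = ¬-not (λ t → x≢y (≡ᵇ⇒≡ x y (Equivalence.from T-≡ t)))

_∪[_] : (ℕ → Bool) → ℕ → ℕ → Bool
(f ∪[ h ]) x = f x ∨ (x ≡ᵇ h)

_∖[_] : (ℕ → Bool) → ℕ → ℕ → Bool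
(f ∖[ m ]) x = f x ∧ not (x ≡ᵇ m)

module _ (f : ℕ → Bool) where

  ∪[]-∈ : ∀ {h x} → x ∈ f → x ∈ f ∪[ h ]
  ∪[]-∈ x∈ rewrite x∈ = refl

  ∪[]-∈-self : ∀ h → h ∈ f ∪[ h ]
  ∪[]-∈-self h rewrite ≡ᵇ-refl h = ∨-zeroʳ (f h)

  ∪[]-agree : ∀ {h x} → x ≢ h → (f ∪[ h ]) x ≡ f x
  ∪[]-agree {x = x} x≢h rewrite ≢⇒≡ᵇ≡false x≢h = ∨-identityʳ (f x)

  ∪[]-∉ : ∀ {h x} → x ∉ f → x ≢ h → x ∉ f ∪[ h ]
  ∪[]-∉ x∉ x≢h = trans (∪[]-agree x≢h) x∉

  ∪[]-∈⁻ : ∀ {h x} → x ∈ f ∪[ h ] → x ∈ f ⊎ x ≡ h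
  ∪[]-∈⁻ {h} {x} x∈ with ∨-true⁻ {f x} x∈
  ... | inj₁ x∈f = inj₁ x∈f
  ... | inj₂ x≡ᵇh = inj₂ (≡ᵇ⇒≡ x h (Equivalence.from T-≡ x≡ᵇh))

  ∖[]-agree : ∀ {m x} → x ≢ m → (f ∖[ m ]) x ≡ f x
  ∖[]-agree {x = x} x≢m rewrite ≢⇒≡ᵇ≡false x≢m = ∧-identityʳ (f x)

  ∖[]-∈ : ∀ {m x} → x ∈ f → x ≢ m → x ∈ f ∖[ m ]
  ∖[]-∈ x∈ x≢m = trans (∖[]-agree x≢m) x∈

  ∖[]-∉ : ∀ {m x} → x ∉ f → x ∉ f ∖[ m ]
  ∖[]-∉ x∉ rewrite x∉ = refl

  ∖[]-∉-self : ∀ m → m ∉ f ∖[ m ]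
  ∖[]-∉-self m rewrite ≡ᵇ-refl m = ∧-zeroʳ (f m)

  ∖[]-∈⁻ : ∀ {m x} → x ∈ f ∖[ m ] → x ∈ f × x ≢ m
  ∖[]-∈⁻ {m} {x} x∈ with ∧-true⁻ {f x} x∈
  ... | x∈f , x≢ᵇm = x∈f , λ { refl → not-¬ (∖[]-∉-self m) x∈ }

length-gapList+countMem : ∀ f k → length (gapList f k) + countMem f k ≡ k
length-gapList+countMem f zero = refl
length-gapList+countMem f (suc k) with f k
... | true  = trans (+-suc _ _) (cong suc (length-gapList+countMem f k))
... | false = cong suc (length-gapList+countMem f k)

genus-cong : ∀ {f g} B → countMem f B ≡ countMem g B → genus f B ≡ genus g B
genus-cong {f} {g} B eq = +-cancelʳ-≡ (countMem f B) (genus f B) (genus g B) (begin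
  genus f B + countMem f B  ≡⟨ length-gapList+countMem f B ⟩
  B                         ≡⟨ length-gapList+countMem g B ⟨
  genus g B + countMem g B  ≡⟨ cong (genus g B +_) eq ⟨
  genus g B + countMem f B  ∎)
  where open ≡-Reasoning

countMem-agree : ∀ {f g k} → (∀ {x} → x < k → g x ≡ f x) → countMem g k ≡ countMem f k
countMem-agree {k = zero} _ = refl
countMem-agree {f} {g} {suc k} agree
  rewrite agree (n<1+n k) | countMem-agree {f} {g} {k} (λ x<k → agree (m<n⇒m<1+n x<k)) = refl

countMem-insert : ∀ {f g b k} → (∀ {x} → x ≢ b → g x ≡ f x) → b ∉ f → b ∈ g → b < k →
  countMem g k ≡ suc (countMem f k)
countMem-insert {f} {g} {b} {suc k} agree b∉ b∈ b<1+k with m<1+n⇒m<n∨m≡n b<1+k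
... | inj₂ refl rewrite b∉ | b∈ = cong suc (countMem-agree (λ x<b → agree (<⇒≢ x<b)))
... | inj₁ b<k rewrite agree (>⇒≢ b<k) | countMem-insert agree b∉ b∈ b<k with f k
...   | true  = refl
...   | false = refl

countMem-∪[] : ∀ {f h k} → h ∉ f → h < k → countMem (f ∪[ h ]) k ≡ suc (countMem f k)
countMem-∪[] {f} {h} h∉ = countMem-insert (∪[]-agree f) h∉ (∪[]-∈-self f h)

countMem-∖[] : ∀ {f m k} → m ∈ f → m < k → countMem f k ≡ suc (countMem (f ∖[ m ]) k)
countMem-∖[] {f} {m} m∈ = countMem-insert (λ x≢m → sym (∖[]-agree f x≢m)) (∖[]-∉-self f m) m∈

countMem-members : ∀ {f a b} → a ≤ b → (∀ {x} → a ≤ x → x < b → x ∈ f) →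
  countMem f b ≡ (b ∸ a) + countMem f a
countMem-members {b = zero} z≤n _ = refl
countMem-members {f} {a} {suc b} a≤1+b all∈ with m≤n⇒m<n∨m≡n a≤1+b
... | inj₂ refl rewrite n∸n≡0 b = refl
... | inj₁ a<1+b rewrite all∈ (m<1+n⇒m≤n a<1+b) (n<1+n b) | +-∸-assoc 1 (m<1+n⇒m≤n a<1+b) =
  cong suc (countMem-members (m<1+n⇒m≤n a<1+b) (λ a≤x x<b → all∈ a≤x (m<n⇒m<1+n x<b)))

countMem-gaps : ∀ {f a b} → a ≤ b → (∀ {x} → a ≤ x → x < b → x ∉ f) → countMem f b ≡ countMem f a
countMem-gaps {b = zero} z≤n _ = refl
countMem-gaps {f} {a} {suc b} a≤1+b all∉ with m≤n⇒m<n∨m≡n a≤1+b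
... | inj₂ refl = refl
... | inj₁ a<1+b rewrite all∉ (m<1+n⇒m≤n a<1+b) (n<1+n b) =
  countMem-gaps (m<1+n⇒m≤n a<1+b) (λ a≤x x<b → all∉ a≤x (m<n⇒m<1+n x<b))

record IsLeastMemberFrom (f : ℕ → Bool) (x y : ℕ) : Set where
  field
    member : y ∈ f
    lower  : x ≤ y
    least  : ∀ {z} → x ≤ z → z < y → z ∉ f

firstFrom-isLeast : ∀ f x k → x + k ∈ f → IsLeastMemberFrom f x (firstFrom f x k)
firstFrom-isLeast f x zero x∈ rewrite +-identityʳ x =
  record { member = x∈ ; lower = ≤-refl ; least = λ x≤z z<x → contradiction x≤z (<⇒≱ z<x) }
firstFrom-isLeast f x (suc k) x+k∈ with f x in fx
... | true = record { member = fx ; lower = ≤-refl ; least = λ x≤z z<x → contradiction x≤z (<⇒≱ z<x) }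
... | false = record { member = member ; lower = <⇒≤ lower ; least = least′ }
  where
  open IsLeastMemberFrom (firstFrom-isLeast f (suc x) k (subst (_∈ f) (+-suc x k) x+k∈))
  least′ : ∀ {z} → x ≤ z → z < firstFrom f (suc x) k → z ∉ f
  least′ x≤z z<y with m≤n⇒m<n∨m≡n x≤z
  ... | inj₁ x<z = least x<z z<y
  ... | inj₂ refl = fx

allBelow⁻ : ∀ k p → allBelow k p ≡ true → ∀ {s} → s < k → p s ≡ true
allBelow⁻ (suc k) p all {s} s<1+k with ∧-true⁻ {allBelow k p} all | m<1+n⇒m<n∨m≡n s<1+k
... | below , _ | inj₁ s<k  = allBelow⁻ k p below s<k
... | _ , at-k  | inj₂ refl = at-k

allBelow⁺ : ∀ k p → (∀ {s} → s < k → p s ≡ true) → allBelow k p ≡ true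
allBelow⁺ zero    p _   = refl
allBelow⁺ (suc k) p all rewrite allBelow⁺ k p (λ s<k → all (m<n⇒m<1+n s<k)) = all (n<1+n k)

record IsLargestGapBelow (f : ℕ → Bool) (k g : ℕ) : Set where
  field
    gap    : g ∉ f
    <bound : g < k
    >gap⇒∈ : ∀ {x} → g < x → x < k → x ∈ f

open IsLargestGapBelow

largestGapBelow : ∀ f k {x} → x < k → x ∉ f → ∃[ g ] IsLargestGapBelow f k g × x ≤ g
largestGapBelow f (suc k) {x} x<1+k x∉ with f k in fk
... | false = k , record { gap = fk ; <bound = n<1+n k ; >gap⇒∈ = none } , m<1+n⇒m≤n x<1+k
  where
  none : ∀ {y} → k < y → y < suc k → y ∈ f
  none k<y y<1+k = contradiction (m<1+n⇒m≤n y<1+k) (<⇒≱ k<y)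
... | true with m<1+n⇒m<n∨m≡n x<1+k
...   | inj₂ refl = contradiction fk (not-¬ x∉)
...   | inj₁ x<k with largestGapBelow f k x<k x∉
...     | g , L , x≤g = g , record { gap = gap L ; <bound = m<n⇒m<1+n (<bound L) ; >gap⇒∈ = above } , x≤g
  where
  above : ∀ {y} → g < y → y < suc k → y ∈ f
  above g<y y<1+k with m<1+n⇒m<n∨m≡n y<1+k
  ... | inj₁ y<k  = >gap⇒∈ L g<y y<k
  ... | inj₂ refl = fk

gapList-largestGap : ∀ {f k g} → IsLargestGapBelow f k g → gapList f k ≡ g ∷ gapList f g
gapList-largestGap {f} {suc k} {g} L with m<1+n⇒m<n∨m≡n (<bound L)
... | inj₂ refl rewrite gap L = refl
... | inj₁ g<k rewrite >gap⇒∈ L g<k (n<1+n k) = gapList-largestGap record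
  { gap = gap L ; <bound = g<k ; >gap⇒∈ = λ g<x x<k → >gap⇒∈ L g<x (m<n⇒m<1+n x<k) }

filterᵇ-gapList-head : ∀ p f k {h rest} → filterᵇ p (gapList f k) ≡ h ∷ rest → p h ≡ true × h < k
filterᵇ-gapList-head p f (suc k) eq with f k
... | true = map₂ m<n⇒m<1+n (filterᵇ-gapList-head p f k eq)
... | false with p k in pk
...   | true with refl ← eq = pk , n<1+n k
...   | false = map₂ m<n⇒m<1+n (filterᵇ-gapList-head p f k eq)

filterᵇ-gapList-nonempty : ∀ p f k {x} → x < k → x ∉ f → p x ≡ true →
  ∃[ h ] ∃[ rest ] filterᵇ p (gapList f k) ≡ h ∷ rest × x ≤ h
filterᵇ-gapList-nonempty p f (suc k) {x} x<1+k x∉ px with f k in fk | m<1+n⇒m<n∨m≡n x<1+k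
... | true  | inj₁ x<k  = filterᵇ-gapList-nonempty p f k x<k x∉ px
... | true  | inj₂ refl = contradiction fk (not-¬ x∉)
... | false | x<k⊎x≡k with p k in pk
...   | true = k , _ , refl , m<1+n⇒m≤n x<1+k
...   | false with x<k⊎x≡k
...     | inj₁ x<k  = filterᵇ-gapList-nonempty p f k x<k x∉ px
...     | inj₂ refl = contradiction px (not-¬ pk)

isSG⇒∉ : ∀ f B {h} → isSG f B h ≡ true → h ∉ f
isSG⇒∉ f B {h} e = not-injective (proj₁ (∧-true⁻ {not (f h)} e))

record IsSpecialGap (f : ℕ → Bool) (h : ℕ) : Set where
  field
    special∉   : h ∉ f
    double∈    : h + h ∈ f
    translate∈ : ∀ {s} → 0 < s → s ∈ f → h + s ∈ f

open IsSpecialGap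

record IsNumericalSemigroup (B F : ℕ) (f : ℕ → Bool) : Set where
  field
    0∈       : 0 ∈ f
    +-closed : ∀ {a b} → a ∈ f → b ∈ f → a + b ∈ f
    ≥B⇒∈     : ∀ {x} → B ≤ x → x ∈ f
    F∉       : F ∉ f
    >F⇒∈     : ∀ {x} → F < x → x ∈ f

frobenius-exists : ∀ (S : NumericalSemigroup) {h} → h ∉ mem S →
  ∃[ F ] IsNumericalSemigroup (bound S) F (mem S) × h ≤ F
frobenius-exists S {h} h∉
  with largestGapBelow (mem S) (bound S) (≰⇒> λ B≤h → not-¬ h∉ (cofinite S h B≤h)) h∉
... | F , L , h≤F = F , isNS , h≤F
  where
  >F⇒∈ : ∀ {x} → F < x → x ∈ mem S
  >F⇒∈ {x} F<x with x <? bound S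
  ... | yes x<B = >gap⇒∈ L F<x x<B
  ... | no x≮B  = cofinite S x (≮⇒≥ x≮B)
  isNS : IsNumericalSemigroup (bound S) F (mem S)
  isNS = record { 0∈ = zero∈ S ; +-closed = closed S _ _ ; ≥B⇒∈ = cofinite S _ ; F∉ = gap L ; >F⇒∈ = >F⇒∈ }

stepA-∷ : ∀ {f B h rest} → sgMinusF f B ≡ h ∷ rest → mult f B < h →
  stepA f B ≡ just (f ∪[ h ] ∖[ mult f B ])
stepA-∷ eq m<h rewrite eq | Equivalence.to T-≡ (<⇒<ᵇ m<h) = refl

if-just : ∀ (b : Bool) {X Y : ℕ → Bool} → (if b then just X else nothing) ≡ just Y → b ≡ true × X ≡ Y
if-just true refl = refl , refl

module Properties {B F f} (S : IsNumericalSemigroup B F f) where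
  open IsNumericalSemigroup S

  F<B : F < B
  F<B = ≰⇒> (λ B≤F → not-¬ F∉ (≥B⇒∈ B≤F))

  gapList≡ : gapList f B ≡ F ∷ gapList f F
  gapList≡ = gapList-largestGap record { gap = F∉ ; <bound = F<B ; >gap⇒∈ = λ F<x _ → >F⇒∈ F<x }

  frob≡ : frob f B ≡ F
  frob≡ rewrite gapList≡ = refl

  nval≡ : nval f B ≡ countMem f F
  nval≡ rewrite gapList≡ = refl

  sgMinusF≡ : sgMinusF f B ≡ filterᵇ (isSG f B) (gapList f F)
  sgMinusF≡ = cong (λ gaps → filterᵇ (isSG f B) (tailL gaps)) gapList≡

  mult-isLeast : IsLeastMemberFrom f 1 (mult f B)
  mult-isLeast = firstFrom-isLeast f 1 B (≥B⇒∈ (n≤1+n B))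

  mult∈ : mult f B ∈ f
  mult∈ = IsLeastMemberFrom.member mult-isLeast

  0<mult : 0 < mult f B
  0<mult = IsLeastMemberFrom.lower mult-isLeast

  mult≤ : ∀ {s} → 0 < s → s ∈ f → mult f B ≤ s
  mult≤ 0<s s∈ = ≮⇒≥ (λ s<m → not-¬ (IsLeastMemberFrom.least mult-isLeast 0<s s<m) s∈)

  2≤mult : 2 ≤ mult f B
  2≤mult = ≤∧≢⇒< 0<mult (λ 1≡m → not-¬ F∉ (all∈ (subst (_∈ f) (sym 1≡m) mult∈) F))
    where
    all∈ : 1 ∈ f → ∀ x → x ∈ f
    all∈ 1∈ zero    = 0∈
    all∈ 1∈ (suc x) = +-closed 1∈ (all∈ 1∈ x)

  isSG⇒special : ∀ {h} → isSG f B h ≡ true → IsSpecialGap f h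
  isSG⇒special {h} e with ∧-true⁻ {f (h + h)} (proj₂ (∧-true⁻ {not (f h)} e))
  ... | hh∈ , translates = record { special∉ = isSG⇒∉ f B e ; double∈ = hh∈ ; translate∈ = translate }
    where
    translate : ∀ {s} → 0 < s → s ∈ f → h + s ∈ f
    translate {s} 0<s s∈ with s <? B
    ... | no s≮B = ≥B⇒∈ (≤-trans (≮⇒≥ s≮B) (m≤n+m s h))
    ... | yes s<B with allBelow⁻ B _ translates s<B
    ...   | h+s∈ rewrite ≢⇒≡ᵇ≡false (>⇒≢ 0<s) | s∈ = h+s∈

  special⇒isSG : ∀ {h} → IsSpecialGap f h → isSG f B h ≡ true
  special⇒isSG {h} sg rewrite special∉ sg | double∈ sg = allBelow⁺ B _ translates
    where
    translates : ∀ {s} → s < B → ((s ≡ᵇ 0) ∨ not (f s) ∨ f (h + s)) ≡ true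
    translates {zero}  _ = refl
    translates {suc s} _ with f (suc s) in s∈
    ... | false = refl
    ... | true  = translate∈ sg z<s s∈

  stepA-defined : ∀ {h} → IsSpecialGap f h → h < F → mult f B < h → ∃[ f′ ] stepA f B ≡ just f′
  stepA-defined {h} sg h<F m<h
    with filterᵇ-gapList-nonempty (isSG f B) f F h<F (special∉ sg) (special⇒isSG sg)
  ... | h′ , rest , eq , h≤h′ = _ , stepA-∷ {f} {B} (trans sgMinusF≡ eq) (<-≤-trans m<h h≤h′)

  stepA-just⇒ : ∀ {f′} → stepA f B ≡ just f′ →
    ∃[ h ] IsSpecialGap f h × h < F × mult f B < h × f′ ≡ f ∪[ h ] ∖[ mult f B ]
  stepA-just⇒ e with sgMinusF f B in eq
  stepA-just⇒ () | []
  ... | h ∷ rest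
    with if-just (mult f B <ᵇ h) e | filterᵇ-gapList-head (isSG f B) f F (trans (sym sgMinusF≡) eq)
  ...   | m<ᵇh , refl | h-isSG , h<F =
    h , isSG⇒special h-isSG , h<F , <ᵇ⇒< _ _ (Equivalence.from T-≡ m<ᵇh) , refl

module Exchange {B F f h} (S : IsNumericalSemigroup B F f) (sg : IsSpecialGap f h)
                (h<F : h < F) (m<h : mult f B < h) where
  open IsNumericalSemigroup S
  open Properties S

  private
    m  = mult f B
    f′ = f ∪[ h ] ∖[ m ]

  ∈⇒∈′ : ∀ {x} → x ∈ f → x ≢ m → x ∈ f′
  ∈⇒∈′ x∈ = ∖[]-∈ (f ∪[ h ]) (∪[]-∈ f x∈)

  h∈′ : h ∈ f′
  h∈′ = ∖[]-∈ (f ∪[ h ]) (∪[]-∈-self f h) (>⇒≢ m<h)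

  ∈′⁻ : ∀ {x} → x ∈ f′ → (x ∈ f × x ≢ m) ⊎ x ≡ h
  ∈′⁻ x∈′ with ∖[]-∈⁻ (f ∪[ h ]) x∈′
  ... | x∈ , x≢m with ∪[]-∈⁻ f x∈
  ...   | inj₁ x∈f = inj₁ (x∈f , x≢m)
  ...   | inj₂ x≡h = inj₂ x≡h

  positive∈′⇒>m : ∀ {x} → 0 < x → x ∈ f′ → m < x
  positive∈′⇒>m 0<x x∈′ with ∈′⁻ x∈′
  ... | inj₁ (x∈ , x≢m) = ≤∧≢⇒< (mult≤ 0<x x∈) (≢-sym x≢m)
  ... | inj₂ refl       = m<h

  +∈′⇒∈ : ∀ {a b} → 0 < a → 0 < b → a ∈ f′ → b ∈ f′ → a + b ∈ f
  +∈′⇒∈ {a} 0<a 0<b a∈′ b∈′ with ∈′⁻ a∈′ | ∈′⁻ b∈′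
  ... | inj₁ (a∈ , _) | inj₁ (b∈ , _) = +-closed a∈ b∈
  ... | inj₁ (a∈ , _) | inj₂ refl     = subst (_∈ f) (+-comm h a) (translate∈ sg 0<a a∈)
  ... | inj₂ refl     | inj₁ (b∈ , _) = translate∈ sg 0<b b∈
  ... | inj₂ refl     | inj₂ refl     = double∈ sg

  +-closed′ : ∀ {a b} → a ∈ f′ → b ∈ f′ → a + b ∈ f′
  +-closed′ {zero}  _   b∈′ = b∈′
  +-closed′ {suc a} {zero} a∈′ _ = subst (_∈ f′) (sym (+-identityʳ (suc a))) a∈′
  +-closed′ {suc a} {suc b} a∈′ b∈′ = ∈⇒∈′ (+∈′⇒∈ z<s z<s a∈′ b∈′)
    (>⇒≢ (<-≤-trans (positive∈′⇒>m z<s a∈′) (m≤m+n (suc a) (suc b))))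

  isNumericalSemigroup : IsNumericalSemigroup B F f′
  isNumericalSemigroup = record
    { 0∈       = ∈⇒∈′ 0∈ (<⇒≢ 0<mult)
    ; +-closed = +-closed′
    ; ≥B⇒∈     = λ B≤x → ∈⇒∈′ (≥B⇒∈ B≤x) (>⇒≢ (<-≤-trans m<B B≤x))
    ; F∉       = ∖[]-∉ (f ∪[ h ]) (∪[]-∉ f F∉ (>⇒≢ h<F))
    ; >F⇒∈     = λ F<x → ∈⇒∈′ (>F⇒∈ F<x) (>⇒≢ (<-trans m<F F<x))
    }
    where
    m<F : m < F
    m<F = <-trans m<h h<F
    m<B : m < B
    m<B = <-trans m<F F<B

  private
    module S′ = Properties isNumericalSemigroup

  mult-increases : m < mult f′ B
  mult-increases = positive∈′⇒>m S′.0<mult S′.mult∈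

  mult≤h : mult f′ B ≤ h
  mult≤h = S′.mult≤ (≤-<-trans z≤n m<h) h∈′

  F∸m+m≡F : F ∸ m + m ≡ F
  F∸m+m≡F = m∸n+n≡m (<⇒≤ (<-trans m<h h<F))

  F∸m∉′ : F ∸ m ∉ f′
  F∸m∉′ = ∖[]-∉ (f ∪[ h ]) (∪[]-∉ f (¬-not F∸m∉) F∸m≢h)
    where
    F∸m∉ : ¬ F ∸ m ∈ f
    F∸m∉ d∈ = not-¬ F∉ (subst (_∈ f) F∸m+m≡F (+-closed d∈ mult∈))
    F∸m≢h : F ∸ m ≢ h
    F∸m≢h refl = not-¬ F∉ (subst (_∈ f) F∸m+m≡F (translate∈ sg 0<mult mult∈))

  countMem-preserved : ∀ {k} → h < k → countMem f′ k ≡ countMem f k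
  countMem-preserved {k} h<k = suc-injective (begin
    suc (countMem f′ k)   ≡⟨ countMem-∖[] {f ∪[ h ]} (∪[]-∈ f mult∈) (<-trans m<h h<k) ⟨
    countMem (f ∪[ h ]) k ≡⟨ countMem-∪[] (special∉ sg) h<k ⟩
    suc (countMem f k)    ∎)
    where open ≡-Reasoning

  genus-preserved : genus f′ B ≡ genus f B
  genus-preserved = genus-cong B (countMem-preserved (<-trans h<F F<B))

  nval-preserved : nval f′ B ≡ nval f B
  nval-preserved = trans S′.nval≡ (trans (countMem-preserved h<F) (sym nval≡))

-- The hypotheses hold for T = 𝒜(S) with c = m(S) (see Exchange.F∸m∉′).
module _ {B F T} (S : IsNumericalSemigroup B F T) where
  open IsNumericalSemigroup S
  open Properties S

  largestGap-special : ∀ {c d g} → 0 < c → c < mult T B → d + c ≡ F → d ∉ T →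
    c < g → IsLargestGapBelow T F g → IsSpecialGap T g
  largestGap-special {c} {d} {g} 0<c c<μ d+c≡F d∉ c<g L = record
    { special∉   = gap L
    ; double∈    = beyond-g+c (+-monoʳ-< g c<g)
    ; translate∈ = λ 0<s s∈ → beyond-g+c (+-monoʳ-< g (<-≤-trans c<μ (mult≤ 0<s s∈)))
    }
    where
    F≤g+c : F ≤ g + c
    F≤g+c = ≮⇒≥ λ g+c<F → not-¬ d∉ (>gap⇒∈ L
      (+-cancelʳ-< c g d (subst (g + c <_) (sym d+c≡F) g+c<F))
      (subst (d <_) d+c≡F (m<m+n d 0<c)))
    beyond-g+c : ∀ {x} → g + c < x → x ∈ T
    beyond-g+c g+c<x = >F⇒∈ (≤-<-trans F≤g+c g+c<x)

  innerGap⇒stepA-defined : ∀ {c d k} → 0 < c → c < mult T B → d + c ≡ F → d ∉ T →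
    mult T B < k → k < F → k ∉ T → ∃[ T′ ] stepA T B ≡ just T′
  innerGap⇒stepA-defined 0<c c<μ d+c≡F d∉ μ<k k<F k∉ with largestGapBelow T F k<F k∉
  ... | g , L , k≤g = stepA-defined
    (largestGap-special 0<c c<μ d+c≡F d∉ (<-trans c<μ μ<g) L) (<bound L) μ<g
    where
    μ<g : mult T B < g
    μ<g = <-≤-trans μ<k k≤g

iterA-suc : ∀ {f f′ B} r → stepA f B ≡ just f′ → iterA (suc r) f B ≡ iterA r f′ B
iterA-suc r step rewrite step = refl

record ExchangeLimit (B F : ℕ) (f : ℕ → Bool) : Set where
  field
    steps     : ℕ
    limit     : ℕ → Bool
    iterA≡    : iterA steps f B ≡ just limit
    isNS      : IsNumericalSemigroup B F limit
    2<mult    : 2 < mult limit B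
    mult<F    : mult limit B < F
    interval⊆ : ∀ {x} → mult limit B < x → x < F → x ∈ limit
    genus≡    : genus limit B ≡ genus f B
    nval≡     : nval limit B ≡ nval f B

exchangeLimit-fuel : ∀ fuel {B F f f′} → IsNumericalSemigroup B F f → F ∸ mult f B < fuel →
  stepA f B ≡ just f′ → ExchangeLimit B F f
exchangeLimit-fuel (suc fuel) {B} {F} {f} S measure step with Properties.stepA-just⇒ S step
... | h , sg , h<F , m<h , refl = continue
  where
  module E = Exchange S sg h<F m<h
  f′ = f ∪[ h ] ∖[ mult f B ]

  decreasing : F ∸ mult f′ B < fuel
  decreasing = <-≤-trans (∸-monoʳ-< E.mult-increases (≤-trans E.mult≤h (<⇒≤ h<F))) (s≤s⁻¹ measure)

  continue : ExchangeLimit B F f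
  continue with stepA f′ B in step′
  ... | just f″ = record
    { steps = suc (steps R) ; limit = limit R
    ; iterA≡ = trans (iterA-suc (steps R) step) (iterA≡ R)
    ; isNS = isNS R ; 2<mult = 2<mult R ; mult<F = mult<F R ; interval⊆ = interval⊆ R
    ; genus≡ = trans (genus≡ R) E.genus-preserved
    ; nval≡ = trans (nval≡ R) E.nval-preserved
    }
    where
    open ExchangeLimit
    R = exchangeLimit-fuel fuel E.isNumericalSemigroup decreasing step′
  ... | nothing = record
    { steps = 1 ; limit = f′
    ; iterA≡ = iterA-suc {f} {B = B} 0 step
    ; isNS = E.isNumericalSemigroup
    ; 2<mult = ≤-<-trans (Properties.2≤mult S) E.mult-increases
    ; mult<F = ≤-<-trans E.mult≤h h<F
    ; interval⊆ = interval⊆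
    ; genus≡ = E.genus-preserved
    ; nval≡ = E.nval-preserved
    }
    where
    interval⊆ : ∀ {x} → mult f′ B < x → x < F → x ∈ f′
    interval⊆ {x} μ<x x<F with f′ x in f′x
    ... | true  = refl
    ... | false with innerGap⇒stepA-defined E.isNumericalSemigroup (Properties.0<mult S)
                       E.mult-increases E.F∸m+m≡F E.F∸m∉′ μ<x x<F f′x
    ...   | _ , defined with () ← trans (sym step′) defined

exchangeLimit : ∀ {B F f f′} → IsNumericalSemigroup B F f → stepA f B ≡ just f′ → ExchangeLimit B F f
exchangeLimit {B} {F} {f} S = exchangeLimit-fuel (suc (F ∸ mult f B)) S ≤-refl

almostOrdinaryMem-true⇔ : ∀ g n x →
  almostOrdinaryMem g n x ≡ true ⇔ (x ≡ 0 ⊎ (g ≤ x × x < g + n ∸ 1) ⊎ g + n ≤ x)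
almostOrdinaryMem-true⇔ g n x = mk⇔ to from
  where
  to : almostOrdinaryMem g n x ≡ true → x ≡ 0 ⊎ (g ≤ x × x < g + n ∸ 1) ⊎ g + n ≤ x
  to e with Equivalence.to T-∨ (Equivalence.from T-≡ e)
  ... | inj₁ x≡ᵇ0 = inj₁ (≡ᵇ⇒≡ x 0 x≡ᵇ0)
  ... | inj₂ t with Equivalence.to T-∨ t
  ...   | inj₂ g+n≤ᵇx = inj₂ (inj₂ (≤ᵇ⇒≤ _ _ g+n≤ᵇx))
  ...   | inj₁ t′ with Equivalence.to T-∧ t′
  ...     | g≤ᵇx , x<ᵇ = inj₂ (inj₁ (≤ᵇ⇒≤ g x g≤ᵇx , <ᵇ⇒< _ _ x<ᵇ))
  from : x ≡ 0 ⊎ (g ≤ x × x < g + n ∸ 1) ⊎ g + n ≤ x → almostOrdinaryMem g n x ≡ true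
  from p = Equivalence.to T-≡ (Equivalence.from T-∨ (Sum.map (≡⇒≡ᵇ x 0) middle-or-above p))
    where
    middle-or-above : (g ≤ x × x < g + n ∸ 1) ⊎ g + n ≤ x → _
    middle-or-above (inj₁ (g≤x , x<)) = Equivalence.from T-∨ (inj₁ (Equivalence.from T-∧ (≤⇒≤ᵇ g≤x , <⇒<ᵇ x<)))
    middle-or-above (inj₂ g+n≤x)      = Equivalence.from T-∨ (inj₂ (≤⇒≤ᵇ g+n≤x))

AlmostOrdinaryWith : (ℕ → Bool) → ℕ → ℕ → Set
AlmostOrdinaryWith T g n = (∀ x → T x ≡ almostOrdinaryMem g n x) × 2 < g × 2 ≤ n × n ≤ g

module AlmostOrdinary {B F T} (S : IsNumericalSemigroup B F T) (μ<F : mult T B < F)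
                      (interval⊆ : ∀ {x} → mult T B < x → x < F → x ∈ T) where
  open IsNumericalSemigroup S
  open Properties S

  private
    μ = mult T B
    n = suc (F ∸ μ)

  μ≤F : μ ≤ F
  μ≤F = <⇒≤ μ<F

  μ≤x<F⇒∈ : ∀ {x} → μ ≤ x → x < F → x ∈ T
  μ≤x<F⇒∈ μ≤x x<F with m≤n⇒m<n∨m≡n μ≤x
  ... | inj₁ μ<x  = interval⊆ μ<x x<F
  ... | inj₂ refl = mult∈

  countMem-F : countMem T F ≡ n
  countMem-F = begin
    countMem T F            ≡⟨ countMem-members μ≤F μ≤x<F⇒∈ ⟩
    (F ∸ μ) + countMem T μ  ≡⟨ cong ((F ∸ μ) +_) (countMem-gaps 0<mult below-μ) ⟩
    (F ∸ μ) + countMem T 1  ≡⟨ cong (λ b → (F ∸ μ) + (if b then 1 else 0)) 0∈ ⟩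
    (F ∸ μ) + 1             ≡⟨ +-comm (F ∸ μ) 1 ⟩
    n                       ∎
    where
    open ≡-Reasoning
    below-μ : ∀ {x} → 1 ≤ x → x < μ → x ∉ T
    below-μ = IsLeastMemberFrom.least mult-isLeast

  nval≡n : nval T B ≡ n
  nval≡n = trans nval≡ countMem-F

  genus≡μ : genus T B ≡ μ
  genus≡μ = +-cancelʳ-≡ (F ∸ μ) (genus T B) μ (begin
    genus T B + (F ∸ μ)                    ≡⟨ cong (λ gaps → length gaps + (F ∸ μ)) gapList≡ ⟩
    suc (length (gapList T F)) + (F ∸ μ)   ≡⟨ +-suc (length (gapList T F)) (F ∸ μ) ⟨
    length (gapList T F) + n               ≡⟨ cong (length (gapList T F) +_) countMem-F ⟨
    length (gapList T F) + countMem T F    ≡⟨ length-gapList+countMem T F ⟩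
    F                                      ≡⟨ m+[n∸m]≡n μ≤F ⟨
    μ + (F ∸ μ)                            ∎)
    where open ≡-Reasoning

  μ+n≡1+F : μ + n ≡ suc F
  μ+n≡1+F = trans (+-suc μ (F ∸ μ)) (cong suc (m+[n∸m]≡n μ≤F))

  ∈⇒shape : ∀ {x} → x ∈ T → x ≡ 0 ⊎ (μ ≤ x × x < F) ⊎ F < x
  ∈⇒shape {zero}  _  = inj₁ refl
  ∈⇒shape {suc y} y∈ with <-cmp (suc y) F
  ... | tri< y<F _ _  = inj₂ (inj₁ (mult≤ z<s y∈ , y<F))
  ... | tri≈ _ refl _ = contradiction y∈ (not-¬ F∉)
  ... | tri> _ _ F<y  = inj₂ (inj₂ F<y)

  shape⇒∈ : ∀ {x} → x ≡ 0 ⊎ (μ ≤ x × x < F) ⊎ F < x → x ∈ T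
  shape⇒∈ (inj₁ refl)               = 0∈
  shape⇒∈ (inj₂ (inj₁ (μ≤x , x<F))) = μ≤x<F⇒∈ μ≤x x<F
  shape⇒∈ (inj₂ (inj₂ F<x))         = >F⇒∈ F<x

  mem⇔ : ∀ x → x ∈ T ⇔ (x ≡ 0 ⊎ (μ ≤ x × x < μ + n ∸ 1) ⊎ μ + n ≤ x)
  mem⇔ x rewrite μ+n≡1+F = mk⇔ ∈⇒shape shape⇒∈

  n≤μ : n ≤ μ
  n≤μ = ≰⇒> λ μ≤F∸μ → not-¬ F∉ (subst (_∈ T) (m+[n∸m]≡n μ≤F)
    (+-closed mult∈ (μ≤x<F⇒∈ μ≤F∸μ (∸-monoʳ-< 0<mult μ≤F))))

  almostOrdinary : 2 < μ → AlmostOrdinaryWith T (genus T B) (nval T B)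
  almostOrdinary 2<μ rewrite genus≡μ | nval≡n =
      (λ x → ⇔→≡ (⇔-sym (almostOrdinaryMem-true⇔ μ n x) ⇔-∘ mem⇔ x))
    , 2<μ , s≤s (m<n⇒0<n∸m μ<F) , n≤μ

theorem4p5 : (S : NumericalSemigroup) → NonSpecial (mem S) (bound S) →
    ∃[ r ] ∃[ T ] (iterA r (mem S) (bound S) ≡ just T
      × (∀ x → T x ≡ almostOrdinaryMem (genus (mem S) (bound S)) (nval (mem S) (bound S)) x)
      × 2 < genus (mem S) (bound S)
      × 2 ≤ nval (mem S) (bound S)
      × nval (mem S) (bound S) ≤ genus (mem S) (bound S))
theorem4p5 S (h , h-isSG , h≢frob , m<h) with frobenius-exists S (isSG⇒∉ (mem S) (bound S) h-isSG)
... | F , S′ , h≤F =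
  steps , limit , iterA≡ ,
  subst₂ (AlmostOrdinaryWith limit) genus≡ nval≡ (AlmostOrdinary.almostOrdinary isNS mult<F interval⊆ 2<mult)
  where
  h<F : h < F
  h<F = ≤∧≢⇒< h≤F (λ h≡F → h≢frob (trans h≡F (sym (Properties.frob≡ S′))))
  open ExchangeLimit (exchangeLimit S′
    (proj₂ (Properties.stepA-defined S′ (Properties.isSG⇒special S′ h-isSG) h<F m<h)))
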